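{- Let $T$ be a finite tree, rooted and embedded in the plane as described in the context, and let $K_4T$ be its $4$-interaction graph. A vertex $v=(k,x,p,q)$ of $K_4T$ is an isolated vertex of $K_4T$ if at least one of the following holds: (i) $k=1$; (ii) the sum of the entries of $p$ is $2$.
   Context: Let $T$ be a finite tree embedded in the plane, rooted at a vertex $\star$ of degree one; $d(x)$ denotes the degree of a vertex $x$ in $T$. At each vertex $x$ the incident edges are numbered $0,1,\dots,d(x)-1$ via the embedding, edge $0$ being the edge at $x$ lying on the unique path from $x$ to $\star$. For distinct vertices $x,y$: $y$ lies on $x$-direction $i$ (with $1\le i\le d(x)-1$) if $x$ lies on the unique path from $y$ to $\star$ and this path contains the $i$-th edge at $x$; in this case $x$ lies on $y$-direction $0$. If $x$ is not on the $y\star$ path and $y$ is not on the $x\star$ path, then $x$ and $y$ are said to be not stacked, and each lies on the other's direction $0$; otherwise they are stacked. The graph $K_4T$ is defined as follows. Its vertices are the $4$-tuples $(k,x,p,q)$ where $x$ is a vertex of $T$ with $d(x)\ge 3$, $k$ is a non-negative integer, and $p=(p_1,\dots,p_{l(p)})$, $q=(q_1,\dots,q_{l(q)})$ are vectors of non-negative integers such that $p$ has at least one positive entry, $l(p)+l(q)=d(x)-1$, and the sum of all entries of $p$ and $q$ is $3-k$. Two vertices $v,w$ are adjacent iff, for one of the two orderings of the pair, writing $v=(k_1,x_1,p_1,q_1)$ and $w=(k_2,x_2,p_2,q_2)$ (with $p_{1,i}$, $q_{1,i}$ the $i$-th entries of $p_1,q_1$), one of the following holds: (1) $x_1,x_2$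 are not stacked and $k_1+k_2\ge 4$; (2) $x_2$ lies on $x_1$-direction $i$ with $1\le i\le l(p_1)$, and either $p_{1,i}>4-k_2$, or $p_{1,i}+k_2=4$ and there is $j\ne i$ with $p_{1,j}\neq 0$; (3) $x_2$ lies on $x_1$-direction $i$ with $i>l(p_1)$, and $q_{1,i-l(p_1)}>4-k_2$. -}

module Defs where

open import Data.Nat using (ℕ; zero; suc; _+_; _∸_; _≤_; _<_; _>_; _≥_)
open import Data.List using (List; []; _∷_; _++_; length)
open import Data.Nat.ListAction using (sum)
open import Data.Maybe using (Maybe; just; nothing)
open import Data.Product using (Σ; ∃; ∃-syntax; _×_; _,_)
open import Data.Sum using (_⊎_)
open import Relation.Nullary using (¬_)
open import Relation.Binary.PropositionalEquality using (_≡_; _≢_)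

-- The planar embedding of a rooted tree is equivalent to the
-- linear order of children at each vertex, read counterclockwise starting
-- from the edge towards the root.
data Tree : Set where
  node : List Tree → Tree

children : Tree → List Tree
children (node ts) = ts

nthT : List Tree → ℕ → Maybe Tree
nthT []       _       = nothing
nthT (t ∷ ts) zero    = just t
nthT (t ∷ ts) (suc n) = nthT ts n

-- Vertices of T are addressed by paths from the root ★ (= []):
-- the path c ∷ rest goes to the c-th child (0-based) and continues.
sub : Tree → List ℕ → Maybe Tree
sub t []         = just t
sub t (c ∷ rest) with nthT (children t) c
... | just s  = sub s rest
... | nothing = nothing

IsVertex : Tree → List ℕ → Set
IsVertex T x = ∃[ s ] (sub T x ≡ just s)

-- degree of a vertex: number of children, plus one for the parent edge
-- unless the vertex is the root ★ = [].  (Non-vertices get degree 0.)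
deg : Tree → List ℕ → ℕ
deg T x with sub T x
deg T [] | just s = length (children s)
deg T (_ ∷ _) | just s = suc (length (children s))
... | nothing = 0

RootDegOne : Tree → Set
RootDegOne T = deg T [] ≡ 1

-- y lies on x-direction i (i ≥ 1): x is a proper ancestor of y and the
-- x-y path leaves x through its child edge number i, i.e. through the
-- (i-1)-th child (0-based); edge 0 at x is the edge towards ★.
OnDir : List ℕ → List ℕ → ℕ → Set
OnDir x y i = ∃[ c ] ∃[ rest ] (y ≡ x ++ (c ∷ rest) × i ≡ suc c)

Ancestor : List ℕ → List ℕ → Set
Ancestor x y = ∃[ zs ] (y ≡ x ++ zs)

NotStacked : List ℕ → List ℕ → Set
NotStacked x y = ¬ Ancestor x y × ¬ Ancestor y x

-- 1-based entry of a vector (0 outside the range 1..length)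
entry : List ℕ → ℕ → ℕ
entry []       _             = 0
entry (a ∷ as) zero          = 0
entry (a ∷ as) (suc zero)    = a
entry (a ∷ as) (suc (suc n)) = entry as (suc n)

HasPositive : List ℕ → Set
HasPositive p = ∃[ j ] (1 ≤ j × j ≤ length p × entry p j > 0)

record K4Vertex (T : Tree) : Set where
  constructor vtx
  field
    k      : ℕ
    x      : List ℕ
    p      : List ℕ
    q      : List ℕ
    xVert  : IsVertex T x
    degx   : deg T x ≥ 3
    pPos   : HasPositive p
    lenPQ  : length p + length q ≡ deg T x ∸ 1
    sumPQ  : sum p + sum q + k ≡ 3

open K4Vertex public

AdjDir : {T : Tree} → K4Vertex T → K4Vertex T → Set
AdjDir v w =
    (NotStacked (x v) (x w) × k v + k w ≥ 4)
  ⊎ (∃[ i ] (OnDir (x v) (x w) i × 1 ≤ i × i ≤ length (p v) ×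
       (entry (p v) i > 4 ∸ k w
        ⊎ (entry (p v) i + k w ≡ 4 ×
           ∃[ j ] (1 ≤ j × j ≤ length (p v) × j ≢ i × entry (p v) j ≢ 0)))))
  ⊎ (∃[ i ] (OnDir (x v) (x w) i × i > length (p v) ×
       entry (q v) (i ∸ length (p v)) > 4 ∸ k w))

Adjacent : {T : Tree} → K4Vertex T → K4Vertex T → Set
Adjacent v w = AdjDir v w ⊎ AdjDir w v

IsolatedK4 : (T : Tree) → K4Vertex T → Set
IsolatedK4 T v = (w : K4Vertex T) → ¬ Adjacent v w

{-# OPTIONS --safe #-}
module Submission where

open import Defs
open import Data.Nat.ListAction using (sum)
open import Data.Sum using (_⊎_; inj₁; inj₂; [_,_])
open import Relation.Binary.PropositionalEquality using (_≡_; refl; _≢_; cong; module ≡-Reasoning)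
open import Data.Nat using (zero; suc; _+_; _∸_; _≤_; _<_; z≤n; s≤s⁻¹)
open import Data.Nat.Properties
open import Data.List using ([]; _∷_)
open import Data.Product using (_×_; _,_)
open import Data.Empty using (⊥-elim)

-- Since p has a positive entry, every vertex has k ≤ 2.  Each adjacency rule
-- for the ordered pair (u, w) forces k u + k w ≥ 4, sum p u + k w ≥ 5 or
-- sum q u + k w ≥ 5 (the second alternative of rule (2) via two distinct
-- entries of p u).  Either hypothesis leaves v with k v ≤ 1, sum p v ≤ 2 and
-- sum q v ≤ 1, so none of these can hold for (v, w) or (w, v).

entry≤sum : ∀ xs i → entry xs i ≤ sum xs
entry≤sum []       i             = z≤n
entry≤sum (a ∷ as) zero          = z≤n
entry≤sum (a ∷ as) (suc zero)    = m≤m+n a (sum as)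
entry≤sum (a ∷ as) (suc (suc i)) = ≤-trans (entry≤sum as (suc i)) (m≤n+m (sum as) a)

entry+entry≤sum : ∀ xs i j → i ≢ j → entry xs i + entry xs j ≤ sum xs
entry+entry≤sum []       i             j             i≢j = z≤n
entry+entry≤sum (a ∷ as) zero          j             i≢j = entry≤sum (a ∷ as) j
entry+entry≤sum (a ∷ as) (suc i)       zero          i≢j
  rewrite +-identityʳ (entry (a ∷ as) (suc i)) = entry≤sum (a ∷ as) (suc i)
entry+entry≤sum (a ∷ as) (suc zero)    (suc zero)    i≢j = ⊥-elim (i≢j refl)
entry+entry≤sum (a ∷ as) (suc zero)    (suc (suc j)) i≢j = +-monoʳ-≤ a (entry≤sum as (suc j))
entry+entry≤sum (a ∷ as) (suc (suc i)) (suc zero)    i≢j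
  rewrite +-comm (entry as (suc i)) a = +-monoʳ-≤ a (entry≤sum as (suc i))
entry+entry≤sum (a ∷ as) (suc (suc i)) (suc (suc j)) i≢j =
  ≤-trans (entry+entry≤sum as (suc i) (suc j) (λ i≡j → i≢j (cong suc i≡j)))
          (m≤n+m (sum as) a)

hasPositive⇒0<sum : ∀ xs → HasPositive xs → 0 < sum xs
hasPositive⇒0<sum xs (j , _ , _ , 0<entry) = ≤-trans 0<entry (entry≤sum xs j)

m∸n<o⇒m<o+n : ∀ m n {o} → m ∸ n < o → m < o + n
m∸n<o⇒m<o+n m n {o} m∸n<o = begin-strict
  m           ≤⟨ m≤n+m∸n m n ⟩
  n + (m ∸ n) <⟨ +-monoʳ-< n m∸n<o ⟩
  n + o       ≡⟨ +-comm n o ⟩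
  o + n       ∎
  where open ≤-Reasoning

module _ {T : Tree} where

  k≤2 : (u : K4Vertex T) → k u ≤ 2
  k≤2 u = s≤s⁻¹ (begin
    1 + k u                     ≤⟨ +-monoˡ-≤ (k u) (hasPositive⇒0<sum (p u) (pPos u)) ⟩
    sum (p u) + k u             ≤⟨ +-monoˡ-≤ (k u) (m≤m+n (sum (p u)) (sum (q u))) ⟩
    sum (p u) + sum (q u) + k u ≡⟨ sumPQ u ⟩
    3                           ∎)
    where open ≤-Reasoning

  sum-p≤3 : (u : K4Vertex T) → sum (p u) ≤ 3
  sum-p≤3 u = ≤-trans (≤-trans (m≤m+n (sum (p u)) (sum (q u))) (m≤m+n _ (k u)))
                      (≤-reflexive (sumPQ u))

  sum-q≤3 : (u : K4Vertex T) → sum (q u) ≤ 3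
  sum-q≤3 u = ≤-trans (≤-trans (m≤n+m (sum (q u)) (sum (p u))) (m≤m+n _ (k u)))
                      (≤-reflexive (sumPQ u))

  adjDir⇒4≤k+k⊎5≤p+k⊎5≤q+k : (u w : K4Vertex T) → AdjDir u w →
    4 ≤ k u + k w ⊎ 5 ≤ sum (p u) + k w ⊎ 5 ≤ sum (q u) + k w
  adjDir⇒4≤k+k⊎5≤p+k⊎5≤q+k _ _ (inj₁ (_ , 4≤k+k)) = inj₁ 4≤k+k
  adjDir⇒4≤k+k⊎5≤p+k⊎5≤q+k u w (inj₂ (inj₁ (i , _ , _ , _ , inj₁ large))) =
    inj₂ (inj₁ (≤-trans (m∸n<o⇒m<o+n 4 (k w) large)
                        (+-monoˡ-≤ (k w) (entry≤sum (p u) i))))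
  adjDir⇒4≤k+k⊎5≤p+k⊎5≤q+k u w
      (inj₂ (inj₁ (i , _ , _ , _ , inj₂ (pᵢ+k≡4 , j , _ , _ , j≢i , pⱼ≢0)))) =
    inj₂ (inj₁ (begin
      1 + 4                                 ≡⟨ cong (1 +_) pᵢ+k≡4 ⟨
      1 + (entry (p u) i + k w)             ≤⟨ +-monoˡ-≤ _ (n≢0⇒n>0 pⱼ≢0) ⟩
      entry (p u) j + (entry (p u) i + k w) ≡⟨ +-assoc (entry (p u) j) _ _ ⟨
      entry (p u) j + entry (p u) i + k w   ≤⟨ +-monoˡ-≤ (k w) (entry+entry≤sum (p u) j i j≢i) ⟩
      sum (p u) + k w                       ∎))
    where open ≤-Reasoning
  adjDir⇒4≤k+k⊎5≤p+k⊎5≤q+k u w (inj₂ (inj₂ (i , _ , _ , large))) =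
    inj₂ (inj₂ (≤-trans (m∸n<o⇒m<o+n 4 (k w) large)
                        (+-monoˡ-≤ (k w) (entry≤sum (q u) _))))

  Light : K4Vertex T → Set
  Light v = k v ≤ 1 × sum (p v) ≤ 2 × sum (q v) ≤ 1

  light⇒isolated : (v : K4Vertex T) → Light v → IsolatedK4 T v
  light⇒isolated v (kv≤1 , pv≤2 , qv≤1) w (inj₁ v→w)
    with adjDir⇒4≤k+k⊎5≤p+k⊎5≤q+k v w v→w
  ... | inj₁ 4≤k+k        = ≤⇒≯ (+-mono-≤ kv≤1 (k≤2 w)) 4≤k+k
  ... | inj₂ (inj₁ 5≤p+k) = ≤⇒≯ (+-mono-≤ pv≤2 (k≤2 w)) 5≤p+k
  ... | inj₂ (inj₂ 5≤q+k) = ≤⇒≯ (+-mono-≤ (m≤n⇒m≤1+n qv≤1) (k≤2 w)) 5≤q+k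
  light⇒isolated v (kv≤1 , pv≤2 , qv≤1) w (inj₂ w→v)
    with adjDir⇒4≤k+k⊎5≤p+k⊎5≤q+k w v w→v
  ... | inj₁ 4≤k+k        = ≤⇒≯ (+-mono-≤ (k≤2 w) kv≤1) 4≤k+k
  ... | inj₂ (inj₁ 5≤p+k) = ≤⇒≯ (+-mono-≤ (sum-p≤3 w) kv≤1) 5≤p+k
  ... | inj₂ (inj₂ 5≤q+k) = ≤⇒≯ (+-mono-≤ (sum-q≤3 w) kv≤1) 5≤q+k

  k≡1⇒light : (v : K4Vertex T) → k v ≡ 1 → Light v
  k≡1⇒light v k≡1 = ≤-reflexive k≡1 , sum-p≤2 , sum-q≤1
    where
    p+q≡2 : sum (p v) + sum (q v) ≡ 2
    p+q≡2 = +-cancelʳ-≡ 1 _ 2 (begin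
      sum (p v) + sum (q v) + 1   ≡⟨ cong (sum (p v) + sum (q v) +_) k≡1 ⟨
      sum (p v) + sum (q v) + k v ≡⟨ sumPQ v ⟩
      3                           ∎)
      where open ≡-Reasoning
    sum-p≤2 : sum (p v) ≤ 2
    sum-p≤2 = ≤-trans (m≤m+n (sum (p v)) (sum (q v))) (≤-reflexive p+q≡2)
    sum-q≤1 : sum (q v) ≤ 1
    sum-q≤1 = s≤s⁻¹ (≤-trans (+-monoˡ-≤ (sum (q v)) (hasPositive⇒0<sum (p v) (pPos v)))
                             (≤-reflexive p+q≡2))

  sum-p≡2⇒light : (v : K4Vertex T) → sum (p v) ≡ 2 → Light v
  sum-p≡2⇒light v p≡2 =
    ≤q+k⇒≤1 (m≤n+m (k v) (sum (q v))) , ≤-reflexive p≡2 , ≤q+k⇒≤1 (m≤m+n (sum (q v)) (k v))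
    where
    q+k≡1 : sum (q v) + k v ≡ 1
    q+k≡1 = +-cancelˡ-≡ 2 _ 1 (begin
      2 + (sum (q v) + k v)         ≡⟨ cong (_+ (sum (q v) + k v)) p≡2 ⟨
      sum (p v) + (sum (q v) + k v) ≡⟨ +-assoc (sum (p v)) _ _ ⟨
      sum (p v) + sum (q v) + k v   ≡⟨ sumPQ v ⟩
      3                             ∎)
      where open ≡-Reasoning
    ≤q+k⇒≤1 : ∀ {n} → n ≤ sum (q v) + k v → n ≤ 1
    ≤q+k⇒≤1 n≤q+k = ≤-trans n≤q+k (≤-reflexive q+k≡1)

mainTheorem1 : (T : Tree) → RootDegOne T → (v : K4Vertex T) →
    (k v ≡ 1 ⊎ sum (p v) ≡ 2) → IsolatedK4 T v
mainTheorem1 T _ v k≡1⊎p≡2 =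
  light⇒isolated v ([ k≡1⇒light v , sum-p≡2⇒light v ] k≡1⊎p≡2)
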